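{- For $n\ge1$ and $1\le k\le n$, $S_q(n,k)=\sum_{e\in I_{n,k}}q^{\mathrm{Inv}(e)}$.
   Context: The $q$-Stirling numbers of the second kind are defined by $S_q(0,0)=1$, $S_q(0,k)=0$ for $k\ne0$, and $S_q(n,k)=q^{n-k}S_q(n-1,k-1)+[k]_qS_q(n-1,k)$ for $n\ge1$, where $[k]_q=1+q+\dots+q^{k-1}$. An inversion sequence of length $n$ is a sequence $e=(e_0,\dots,e_{n-1})$ of integers with $0\le e_i\le i$; $\mathrm{inv}(e)=|\{(i,j):i<j,\ e_i>e_j\}|$. $I_{n,k}$ is the set of inversion sequences of length $n$ having exactly $k$ zero entries whose $n-k$ nonzero entries are pairwise distinct. For $e\in I_{n,k}$, let $S=\{e_i:e_i>0\}$ and $R=\{1,\dots,n-1\}\setminus S$ (so $|R|=k-1$), and define $\mathrm{Inv}(e)=\mathrm{inv}(e)+|\{(i,r):0\le i\le n-1,\ r\in R,\ e_i>r\}|$ (equivalently, the number of inversions of the word obtained by appending the elements of $R$ in increasing order to $e$). -}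

module Defs where

open import Level using (Level)
open import Data.Nat using (ℕ; zero; suc; _∸_; _<ᵇ_; _≡ᵇ_)
open import Data.Bool using (Bool; true; false; _∧_; not; if_then_else_)
open import Data.List using (List; []; _∷_; _++_; [_]; length; filter; map; concatMap; upTo; foldr)
open import Data.Bool.ListAction using (any)
open import Relation.Nullary.Decidable using (T?)
open import Algebra.Bundles using (CommutativeSemiring)

invSeqs : ℕ → List (List ℕ)
invSeqs zero    = [] ∷ []
invSeqs (suc n) = concatMap (λ e → map (λ x → e ++ [ x ]) (upTo (suc n))) (invSeqs n)

elemᵇ : ℕ → List ℕ → Bool
elemᵇ x xs = any (λ y → x ≡ᵇ y) xs

zeros : List ℕ → ℕ
zeros xs = length (filter (λ x → T? (x ≡ᵇ 0)) xs)

nonzeros : List ℕ → List ℕ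
nonzeros xs = filter (λ x → T? (not (x ≡ᵇ 0))) xs

distinctᵇ : List ℕ → Bool
distinctᵇ []       = true
distinctᵇ (x ∷ xs) = not (elemᵇ x xs) ∧ distinctᵇ xs

inIᵇ : ℕ → List ℕ → Bool
inIᵇ k e = (zeros e ≡ᵇ k) ∧ distinctᵇ (nonzeros e)

I : ℕ → ℕ → List (List ℕ)
I n k = filter (λ e → T? (inIᵇ k e)) (invSeqs n)

inv : List ℕ → ℕ
inv []       = 0
inv (x ∷ xs) = length (filter (λ y → T? (y <ᵇ x)) xs) Data.Nat.+ inv xs

Rset : ℕ → List ℕ → List ℕ
Rset n e = filter (λ r → T? (not (elemᵇ r e))) (map suc (upTo (n ∸ 1)))

Inv : ℕ → List ℕ → ℕ
Inv n e = inv (e ++ Rset n e)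

-- q-analogues, valued in an arbitrary commutative semiring
-- (universal over all commutative semirings = polynomial identity in ℕ[q])

module _ {c ℓ : Level} (R : CommutativeSemiring c ℓ) where
  open CommutativeSemiring R

  pow : Carrier → ℕ → Carrier
  pow q zero    = 1#
  pow q (suc m) = q * pow q m

  qint : Carrier → ℕ → Carrier
  qint q zero    = 0#
  qint q (suc k) = qint q k + pow q k

  -- q-Stirling numbers of the second kind (k ranges over ℕ; S_q(n,-1)=0)
  Sq : Carrier → ℕ → ℕ → Carrier
  Sq q zero    zero    = 1#
  Sq q zero    (suc k) = 0#
  Sq q (suc n) zero    = qint q 0 * Sq q n 0
  Sq q (suc n) (suc k) = pow q (n ∸ k) * Sq q n k + qint q (suc k) * Sq q n (suc k)

  invSum : Carrier → ℕ → ℕ → Carrier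
  invSum q n k = foldr (λ e acc → pow q (Inv n e) + acc) 0# (I n k)

module Submission where

open import Defs
open import Level using (Level)
open import Data.Nat using (ℕ; _≤_)
open import Algebra.Bundles using (CommutativeSemiring)

-- Both sides satisfy the recurrence defining S_q, obtained by writing each inversion sequence of
-- length n + 1 as e followed by a last entry x.  Let S be the set of nonzero entries of e and
-- L = {1,…,n} ∖ S (oneTo n without e); the set R of e is L ∖ {n}, and Inv(e) =
-- inv(e) + crossInv e R, where crossInv counts the inversions between a list and a later one.
--   x = 0:  e·0 ∈ I_{n+1,k+1} iff e ∈ I_{n,k}.  The new R is L, and Inv grows by n − k, the number
--           of nonzero entries of e, each of which exceeds the final 0.
--   x ≠ 0:  e·x ∈ I_{n+1,k+1} iff e ∈ I_{n,k+1} and x ∈ L.  The new R is L ∖ {x}, and Inv grows by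
--           the number of elements of L below x.  Since then |L| = k + 1, these extensions
--           contribute [k+1]_q q^Inv(e).
-- Hence Σ_{e ∈ I_{n,k}} q^Inv(e) satisfies the recurrence of S_q; the sums are taken over all of
-- invSeqs n with the weight q^Inv(e) switched off outside I_{n,k}.

module InversionCounting where

  open import Data.Bool using (Bool; true; false; _∧_; _∨_; not)
  open import Data.Bool.Properties using (∧-assoc; ∧-comm; ∧-zeroʳ; ∨-assoc; ∨-zeroʳ; ∨-identityʳ; T-≡)
  open import Data.Nat using (ℕ; zero; suc; _+_; _∸_; _≤_; _<_; _≡ᵇ_; _<ᵇ_; z≤n; s≤s)
  open import Data.Nat.Properties
    using ( +-commutativeSemigroup; +-comm; +-assoc; +-suc; +-identityʳ; +-cancelʳ-≡; m+n∸m≡n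
          ; ≡ᵇ⇒≡; <⇒<ᵇ; <⇒≤; ≤-refl; n<1+n; <-trans; m<n⇒m<1+n)
  open import Data.List using (List; []; _∷_; _++_; [_]; length; filterᵇ; map; upTo; applyUpTo)
  open import Data.List.Properties
    using (length-++; filter-++; filter-all; ++-identityʳ; map-upTo; applyUpTo-∷ʳ; length-applyUpTo)
  open import Data.List.Relation.Unary.All as All using (All; []; _∷_)
  import Data.List.Relation.Unary.All.Properties as All
  open import Data.List.Relation.Unary.AllPairs using (AllPairs; []; _∷_)
  import Data.List.Relation.Unary.AllPairs.Properties as AllPairs
  open import Data.Product using (∃; _,_; _×_; proj₁; proj₂)
  open import Data.Sum using (_⊎_; inj₁; inj₂)
  open import Function using (_∘_; Equivalence)
  open import Relation.Nullary.Decidable using (T?)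
  open import Relation.Binary.PropositionalEquality using (_≡_; refl; sym; trans; cong; cong₂; module ≡-Reasoning)
  open import Data.Nat.Tactic.RingSolver using (solve-∀)
  open import Algebra.Properties.CommutativeSemigroup +-commutativeSemigroup using () renaming (interchange to +-interchange)

  private
    variable
      A : Set

  ≡ᵇ-refl : ∀ n → (n ≡ᵇ n) ≡ true
  ≡ᵇ-refl zero    = refl
  ≡ᵇ-refl (suc n) = ≡ᵇ-refl n

  ≡ᵇ-sym : ∀ m n → (m ≡ᵇ n) ≡ (n ≡ᵇ m)
  ≡ᵇ-sym zero    zero    = refl
  ≡ᵇ-sym zero    (suc n) = refl
  ≡ᵇ-sym (suc m) zero    = refl
  ≡ᵇ-sym (suc m) (suc n) = ≡ᵇ-sym m n

  ≡ᵇ-true⇒≡ : ∀ m n → (m ≡ᵇ n) ≡ true → m ≡ n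
  ≡ᵇ-true⇒≡ m n eq = ≡ᵇ⇒≡ m n (Equivalence.from T-≡ eq)

  <⇒≡ᵇ-false : ∀ {m n} → m < n → (n ≡ᵇ m) ≡ false
  <⇒≡ᵇ-false {zero}  {suc n} _       = refl
  <⇒≡ᵇ-false {suc m} {suc n} (s≤s p) = <⇒≡ᵇ-false p

  <⇒<ᵇ-true : ∀ {m n} → m < n → (m <ᵇ n) ≡ true
  <⇒<ᵇ-true p = Equivalence.to T-≡ (<⇒<ᵇ p)

  ≥⇒<ᵇ-false : ∀ {m n} → n ≤ m → (m <ᵇ n) ≡ false
  ≥⇒<ᵇ-false {m}     {zero}  _       = refl
  ≥⇒<ᵇ-false {suc m} {suc n} (s≤s p) = ≥⇒<ᵇ-false p

  not-∨ : ∀ a b → not (a ∨ b) ≡ not a ∧ not b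
  not-∨ true  b = refl
  not-∨ false b = refl

  ∧-true : ∀ {a b} → (a ∧ b) ≡ true → a ≡ true × b ≡ true
  ∧-true {true} {true} _ = refl , refl

  filterᵇ-cong : (p r : A → Bool) {xs : List A} → All (λ x → p x ≡ r x) xs → filterᵇ p xs ≡ filterᵇ r xs
  filterᵇ-cong p r []                      = refl
  filterᵇ-cong p r {x ∷ xs} (px≡rx ∷ eqs) rewrite px≡rx with r x
  ... | true  = cong (x ∷_) (filterᵇ-cong p r eqs)
  ... | false = filterᵇ-cong p r eqs

  filterᵇ-∧ : (p r : A → Bool) (xs : List A) → filterᵇ (λ x → p x ∧ r x) xs ≡ filterᵇ r (filterᵇ p xs)
  filterᵇ-∧ p r [] = refl
  filterᵇ-∧ p r (x ∷ xs) with p x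
  ... | false = filterᵇ-∧ p r xs
  ... | true with r x
  ...   | true  = cong (x ∷_) (filterᵇ-∧ p r xs)
  ...   | false = filterᵇ-∧ p r xs

  filterᵇ-none : (p : A → Bool) {xs : List A} → All (λ x → p x ≡ false) xs → filterᵇ p xs ≡ []
  filterᵇ-none p []                       = refl
  filterᵇ-none p {x ∷ xs} (px≡false ∷ hs) rewrite px≡false = filterᵇ-none p hs

  length-filterᵇ-partition : (p : A → Bool) (xs : List A) →
    length (filterᵇ p xs) + length (filterᵇ (not ∘ p) xs) ≡ length xs
  length-filterᵇ-partition p [] = refl
  length-filterᵇ-partition p (x ∷ xs) with p x
  ... | true  = cong suc (length-filterᵇ-partition p xs)
  ... | false = trans (+-suc _ _) (cong suc (length-filterᵇ-partition p xs))

  length-filterᵇ-split : (r p : A → Bool) (xs : List A) →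
    length (filterᵇ r xs) ≡ length (filterᵇ r (filterᵇ p xs)) + length (filterᵇ r (filterᵇ (not ∘ p) xs))
  length-filterᵇ-split r p [] = refl
  length-filterᵇ-split r p (x ∷ xs) with p x
  ... | true with r x
  ...   | true  = cong suc (length-filterᵇ-split r p xs)
  ...   | false = length-filterᵇ-split r p xs
  length-filterᵇ-split r p (x ∷ xs) | false with r x
  ...   | true  = trans (cong suc (length-filterᵇ-split r p xs)) (sym (+-suc _ _))
  ...   | false = length-filterᵇ-split r p xs

  _without_ : List ℕ → List ℕ → List ℕ
  xs without ds = filterᵇ (λ r → not (elemᵇ r ds)) xs

  infixl 6 _without_

  elemᵇ-++ : ∀ r (xs ys : List ℕ) → elemᵇ r (xs ++ ys) ≡ elemᵇ r xs ∨ elemᵇ r ys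
  elemᵇ-++ r []       ys = refl
  elemᵇ-++ r (x ∷ xs) ys = trans (cong ((r ≡ᵇ x) ∨_) (elemᵇ-++ r xs ys)) (sym (∨-assoc (r ≡ᵇ x) _ _))

  elemᵇ-∷ : ∀ x {y} xs → elemᵇ y xs ≡ true → elemᵇ y (x ∷ xs) ≡ true
  elemᵇ-∷ x {y} xs y∈xs rewrite y∈xs = ∨-zeroʳ (y ≡ᵇ x)

  elemᵇ-self : (xs : List ℕ) → All (λ x → elemᵇ x xs ≡ true) xs
  elemᵇ-self []       = []
  elemᵇ-self (x ∷ xs) = x∈ ∷ All.map (λ {y} → elemᵇ-∷ x {y} xs) (elemᵇ-self xs)
    where
    x∈ : elemᵇ x (x ∷ xs) ≡ true
    x∈ rewrite ≡ᵇ-refl x = refl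

  elemᵇ-filterᵇ : (p : ℕ → Bool) {d : ℕ} (xs : List ℕ) → p d ≡ true → elemᵇ d xs ≡ true →
    elemᵇ d (filterᵇ p xs) ≡ true
  elemᵇ-filterᵇ p {d} (x ∷ xs) pd d∈ with d ≡ᵇ x in d≡x
  ... | true with refl ← ≡ᵇ-true⇒≡ d x d≡x rewrite pd | ≡ᵇ-refl d = refl
  ... | false with p x
  ...   | true rewrite d≡x = elemᵇ-filterᵇ p xs pd d∈
  ...   | false = elemᵇ-filterᵇ p xs pd d∈

  elemᵇ-applyUpTo : (f : ℕ → ℕ) {i n : ℕ} → i < n → elemᵇ (f i) (applyUpTo f n) ≡ true
  elemᵇ-applyUpTo f {zero}  {suc n} _ rewrite ≡ᵇ-refl (f 0) = refl
  elemᵇ-applyUpTo f {suc i} {suc n} (s≤s i<n) = elemᵇ-∷ (f 0) {f (suc i)} (applyUpTo (f ∘ suc) n) (elemᵇ-applyUpTo (f ∘ suc) i<n)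

  elemᵇ-above : ∀ {n} (xs : List ℕ) → All (_< n) xs → elemᵇ n xs ≡ false
  elemᵇ-above []       []         = refl
  elemᵇ-above (x ∷ xs) (x<n ∷ hs) rewrite <⇒≡ᵇ-false x<n = elemᵇ-above xs hs

  without-++ : ∀ xs ds es → xs without (ds ++ es) ≡ xs without ds without es
  without-++ xs ds es =
    trans (filterᵇ-cong _ (λ r → not (elemᵇ r ds) ∧ not (elemᵇ r es))
            (All.universal (λ r → trans (cong not (elemᵇ-++ r ds es)) (not-∨ (elemᵇ r ds) _)) xs))
          (filterᵇ-∧ (λ r → not (elemᵇ r ds)) (λ r → not (elemᵇ r es)) xs)

  without-∷ : ∀ xs d ds → xs without (d ∷ ds) ≡ xs without ds without [ d ]
  without-∷ xs d ds =
    trans (filterᵇ-cong _ _ (All.universal swap xs))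
          (filterᵇ-∧ (λ r → not (elemᵇ r ds)) (λ r → not (elemᵇ r [ d ])) xs)
    where
    swap : ∀ r → not ((r ≡ᵇ d) ∨ elemᵇ r ds) ≡ not (elemᵇ r ds) ∧ not ((r ≡ᵇ d) ∨ false)
    swap r rewrite ∨-identityʳ (r ≡ᵇ d) = trans (not-∨ (r ≡ᵇ d) _) (∧-comm (not (r ≡ᵇ d)) _)

  Increasing : List ℕ → Set
  Increasing = AllPairs _<_

  filterᵇ-∈ : ∀ {x} L → Increasing L → elemᵇ x L ≡ true → filterᵇ (λ r → elemᵇ r [ x ]) L ≡ [ x ]
  filterᵇ-∈ {x} (y ∷ L) (y<L ∷ incL) x∈ with x ≡ᵇ y in x≡y
  ... | true with refl ← ≡ᵇ-true⇒≡ x y x≡y rewrite ≡ᵇ-refl x =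
    cong (y ∷_) (filterᵇ-none _ (All.map (λ y<z → cong (_∨ false) (<⇒≡ᵇ-false y<z)) y<L))
  ... | false rewrite ≡ᵇ-sym y x | x≡y = filterᵇ-∈ L incL x∈

  length-without-∈ : ∀ {x} L → Increasing L → elemᵇ x L ≡ true → suc (length (L without [ x ])) ≡ length L
  length-without-∈ {x} L inc x∈ =
    trans (cong (λ z → length z + length (L without [ x ])) (sym (filterᵇ-∈ L inc x∈)))
          (length-filterᵇ-partition (λ r → elemᵇ r [ x ]) L)

  length-without : ∀ xs ds → Increasing xs → distinctᵇ ds ≡ true → All (λ d → elemᵇ d xs ≡ true) ds →
    length (xs without ds) + length ds ≡ length xs
  length-without xs [] _ _ _ =
    trans (+-identityʳ _) (cong length (filter-all (λ _ → T? true) (All.universal (λ _ → _) xs)))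
  length-without xs (d ∷ ds) inc distinct (d∈xs ∷ ds⊆xs) = begin
    length (xs without (d ∷ ds)) + suc (length ds)
      ≡⟨ cong (λ z → length z + suc (length ds)) (without-∷ xs d ds) ⟩
    length (xs without ds without [ d ]) + suc (length ds)
      ≡⟨ +-suc _ _ ⟩
    suc (length (xs without ds without [ d ])) + length ds
      ≡⟨ cong (_+ length ds) (length-without-∈ _ (AllPairs.filter⁺ _ inc) d∈) ⟩
    length (xs without ds) + length ds
      ≡⟨ length-without xs ds inc (proj₂ d∉ds,ds) ds⊆xs ⟩
    length xs ∎
    where
    open ≡-Reasoning
    d∉ds,ds = ∧-true {not (elemᵇ d ds)} distinct
    d∈ : elemᵇ d (xs without ds) ≡ true
    d∈ = elemᵇ-filterᵇ (λ r → not (elemᵇ r ds)) {d} xs (proj₁ d∉ds,ds) d∈xs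

  zeros-++ : ∀ xs ys → zeros (xs ++ ys) ≡ zeros xs + zeros ys
  zeros-++ xs ys = trans (cong length (filter-++ _ xs ys)) (length-++ (filterᵇ (_≡ᵇ 0) xs))

  nonzeros-++ : ∀ xs ys → nonzeros (xs ++ ys) ≡ nonzeros xs ++ nonzeros ys
  nonzeros-++ = filter-++ _

  zeros+length-nonzeros : ∀ xs → zeros xs + length (nonzeros xs) ≡ length xs
  zeros+length-nonzeros = length-filterᵇ-partition (_≡ᵇ 0)

  elemᵇ-nonzeros : ∀ y xs → elemᵇ (suc y) (nonzeros xs) ≡ elemᵇ (suc y) xs
  elemᵇ-nonzeros y []           = refl
  elemᵇ-nonzeros y (zero  ∷ xs) = elemᵇ-nonzeros y xs
  elemᵇ-nonzeros y (suc z ∷ xs) = cong ((y ≡ᵇ z) ∨_) (elemᵇ-nonzeros y xs)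

  distinctᵇ-∷ʳ : ∀ xs x → distinctᵇ (xs ++ [ x ]) ≡ distinctᵇ xs ∧ not (elemᵇ x xs)
  distinctᵇ-∷ʳ []       x = refl
  distinctᵇ-∷ʳ (y ∷ xs) x
    rewrite elemᵇ-++ y xs [ x ] | ∨-identityʳ (y ≡ᵇ x) | distinctᵇ-∷ʳ xs x | ≡ᵇ-sym x y
    = shuffle (elemᵇ y xs) (y ≡ᵇ x) (distinctᵇ xs) (elemᵇ x xs)
    where
    shuffle : ∀ a b c d → not (a ∨ b) ∧ (c ∧ not d) ≡ (not a ∧ c) ∧ not (b ∨ d)
    shuffle true  b     c d = refl
    shuffle false true  c d = sym (∧-zeroʳ c)
    shuffle false false c d = refl

  inIᵇ-true : ∀ k e → inIᵇ k e ≡ true → zeros e ≡ k × distinctᵇ (nonzeros e) ≡ true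
  inIᵇ-true k e e∈I with zeros≡k , distinct ← ∧-true {zeros e ≡ᵇ k} e∈I =
    ≡ᵇ-true⇒≡ (zeros e) k zeros≡k , distinct

  inIᵇ-∷ʳ-0 : ∀ k e → inIᵇ (suc k) (e ++ [ 0 ]) ≡ inIᵇ k e
  inIᵇ-∷ʳ-0 k e rewrite zeros-++ e [ 0 ] | +-comm (zeros e) 1 | nonzeros-++ e [ 0 ] | ++-identityʳ (nonzeros e) = refl

  inIᵇ-∷ʳ-suc : ∀ k e y → inIᵇ k (e ++ [ suc y ]) ≡ inIᵇ k e ∧ not (elemᵇ (suc y) e)
  inIᵇ-∷ʳ-suc k e y
    rewrite zeros-++ e [ suc y ] | +-identityʳ (zeros e) | nonzeros-++ e [ suc y ]
          | distinctᵇ-∷ʳ (nonzeros e) (suc y) | elemᵇ-nonzeros y e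
    = sym (∧-assoc (zeros e ≡ᵇ k) _ _)

  countBelow : List ℕ → ℕ → ℕ
  countBelow ys a = length (filterᵇ (_<ᵇ a) ys)

  countBelow-++ : ∀ xs ys a → countBelow (xs ++ ys) a ≡ countBelow xs a + countBelow ys a
  countBelow-++ xs ys a = trans (cong length (filter-++ _ xs ys)) (length-++ (filterᵇ (_<ᵇ a) xs))

  countBelow-none : ∀ {a} ys → All (a ≤_) ys → countBelow ys a ≡ 0
  countBelow-none ys a≤ys = cong length (filterᵇ-none _ (All.map ≥⇒<ᵇ-false a≤ys))

  countBelow-∷-below : ∀ {y x L} → y < x → countBelow (y ∷ L) x ≡ suc (countBelow L x)
  countBelow-∷-below y<x rewrite <⇒<ᵇ-true y<x = refl

  countBelow-without-∈ : ∀ {x} L → Increasing L → elemᵇ x L ≡ true →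
    ∀ a → countBelow L a ≡ countBelow [ x ] a + countBelow (L without [ x ]) a
  countBelow-without-∈ {x} L inc x∈ a =
    trans (length-filterᵇ-split (_<ᵇ a) (λ r → elemᵇ r [ x ]) L)
          (cong (λ z → countBelow z a + countBelow (L without [ x ]) a) (filterᵇ-∈ L inc x∈))

  crossInv : List ℕ → List ℕ → ℕ
  crossInv []       ys = 0
  crossInv (x ∷ xs) ys = countBelow ys x + crossInv xs ys

  crossInv-++ˡ : ∀ xs ys zs → crossInv (xs ++ ys) zs ≡ crossInv xs zs + crossInv ys zs
  crossInv-++ˡ []       ys zs = refl
  crossInv-++ˡ (x ∷ xs) ys zs =
    trans (cong (countBelow zs x +_) (crossInv-++ˡ xs ys zs)) (sym (+-assoc (countBelow zs x) _ _))

  crossInv-++ʳ : ∀ xs ys zs → crossInv xs (ys ++ zs) ≡ crossInv xs ys + crossInv xs zs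
  crossInv-++ʳ []       ys zs = refl
  crossInv-++ʳ (x ∷ xs) ys zs =
    trans (cong₂ _+_ (countBelow-++ ys zs x) (crossInv-++ʳ xs ys zs))
          (+-interchange (countBelow ys x) (countBelow zs x) (crossInv xs ys) (crossInv xs zs))

  crossInv-without-∈ : ∀ {x} L → Increasing L → elemᵇ x L ≡ true →
    ∀ xs → crossInv xs L ≡ crossInv xs [ x ] + crossInv xs (L without [ x ])
  crossInv-without-∈ L inc x∈ []       = refl
  crossInv-without-∈ {x} L inc x∈ (y ∷ xs) =
    trans (cong₂ _+_ (countBelow-without-∈ L inc x∈ y) (crossInv-without-∈ L inc x∈ xs))
          (+-interchange (countBelow [ x ] y) (countBelow L′ y) (crossInv xs [ x ]) (crossInv xs L′))
    where L′ = L without [ x ]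

  crossInv-[0] : ∀ xs → crossInv xs [ 0 ] ≡ length (nonzeros xs)
  crossInv-[0] []           = refl
  crossInv-[0] (zero  ∷ xs) = crossInv-[0] xs
  crossInv-[0] (suc _ ∷ xs) = cong suc (crossInv-[0] xs)

  crossInv-singleton-above : ∀ n xs → All (_≤ n) xs → crossInv xs [ n ] ≡ 0
  crossInv-singleton-above n []       []           = refl
  crossInv-singleton-above n (x ∷ xs) (x≤n ∷ xs≤n) =
    cong₂ _+_ (countBelow-none [ n ] (x≤n ∷ [])) (crossInv-singleton-above n xs xs≤n)

  crossInv-∷ʳ : ∀ xs x ys → crossInv (xs ++ [ x ]) ys ≡ crossInv xs ys + countBelow ys x
  crossInv-∷ʳ xs x ys = trans (crossInv-++ˡ xs [ x ] ys) (cong (crossInv xs ys +_) (+-identityʳ _))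

  inv-++ : ∀ xs ys → inv (xs ++ ys) ≡ inv xs + inv ys + crossInv xs ys
  inv-++ []       ys = sym (+-identityʳ _)
  inv-++ (x ∷ xs) ys = begin
    countBelow (xs ++ ys) x + inv (xs ++ ys)
      ≡⟨ cong₂ _+_ (countBelow-++ xs ys x) (inv-++ xs ys) ⟩
    (countBelow xs x + countBelow ys x) + (inv xs + inv ys + crossInv xs ys)
      ≡⟨ regroup (countBelow xs x) (countBelow ys x) (inv xs) (inv ys) (crossInv xs ys) ⟩
    (countBelow xs x + inv xs) + inv ys + (countBelow ys x + crossInv xs ys) ∎
    where
    open ≡-Reasoning
    regroup : ∀ a b c d e → (a + b) + (c + d + e) ≡ (a + c) + d + (b + e)
    regroup = solve-∀

  inv-increasing : ∀ {xs} → Increasing xs → inv xs ≡ 0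
  inv-increasing {[]}     []             = refl
  inv-increasing {x ∷ xs} (x<xs ∷ inc) = cong₂ _+_ (countBelow-none xs (All.map <⇒≤ x<xs)) (inv-increasing inc)

  inv-++-increasing : ∀ xs {ys} → Increasing ys → inv (xs ++ ys) ≡ inv xs + crossInv xs ys
  inv-++-increasing xs {ys} inc =
    trans (inv-++ xs ys) (cong (_+ crossInv xs ys) (trans (cong (inv xs +_) (inv-increasing inc)) (+-identityʳ _)))

  inv-∷ʳ : ∀ xs x → inv (xs ++ [ x ]) ≡ inv xs + crossInv xs [ x ]
  inv-∷ʳ xs x = inv-++-increasing xs ([] ∷ [])

  -- The invariants of the members of invSeqs n that the counting argument needs (weaker than e_i ≤ i).
  record IsInvSeq (n : ℕ) (e : List ℕ) : Set where
    field
      length≡        : length e ≡ n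
      bounded        : All (_< n) e
      startsWithZero : e ≡ [] ⊎ ∃ λ es → e ≡ 0 ∷ es

  IsInvSeq-∷ʳ : ∀ {n e x} → IsInvSeq n e → x < suc n → IsInvSeq (suc n) (e ++ [ x ])
  IsInvSeq-∷ʳ {n} {e} {x} record { length≡ = refl ; bounded = bounded ; startsWithZero = start } x<1+n = record
    { length≡        = trans (length-++ e) (+-comm (length e) 1)
    ; bounded        = All.++⁺ (All.map m<n⇒m<1+n bounded) (x<1+n ∷ [])
    ; startsWithZero = inj₂ (startsWithZero-∷ʳ start x<1+n)
    }
    where
    startsWithZero-∷ʳ : e ≡ [] ⊎ ∃ (λ es → e ≡ 0 ∷ es) → x < suc n → ∃ λ es → e ++ [ x ] ≡ 0 ∷ es
    startsWithZero-∷ʳ (inj₁ refl)        (s≤s z≤n) = [] , refl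
    startsWithZero-∷ʳ (inj₂ (es , refl)) _         = es ++ [ x ] , refl

  invSeqs-IsInvSeq : ∀ n → All (IsInvSeq n) (invSeqs n)
  invSeqs-IsInvSeq zero    = record { length≡ = refl ; bounded = [] ; startsWithZero = inj₁ refl } ∷ []
  invSeqs-IsInvSeq (suc n) = All.concat⁺ (All.map⁺ (All.map extensions (invSeqs-IsInvSeq n)))
    where
    extensions : ∀ {e} → IsInvSeq n e → All (IsInvSeq (suc n)) (map (λ x → e ++ [ x ]) (upTo (suc n)))
    extensions e-inv = All.map⁺ (All.applyUpTo⁺₁ _ (suc n) (IsInvSeq-∷ʳ e-inv))

  length-nonzeros : ∀ {n e} → IsInvSeq n e → length (nonzeros e) ≡ n ∸ zeros e
  length-nonzeros {n} {e} record { length≡ = length≡ } =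
    trans (sym (m+n∸m≡n (zeros e) _)) (cong (_∸ zeros e) (trans (zeros+length-nonzeros e) length≡))

  oneTo : ℕ → List ℕ
  oneTo n = applyUpTo suc n

  oneTo-increasing : ∀ n → Increasing (oneTo n)
  oneTo-increasing n = AllPairs.applyUpTo⁺₁ suc n (λ i<j _ → s≤s i<j)

  oneTo-without-increasing : ∀ n e → Increasing (oneTo n without e)
  oneTo-without-increasing n e = AllPairs.filter⁺ _ (oneTo-increasing n)

  oneTo-suc-without : ∀ n e → All (_< suc n) e → oneTo (suc n) without e ≡ oneTo n without e ++ [ suc n ]
  oneTo-suc-without n e e<1+n = begin
    oneTo (suc n) without e                          ≡⟨ cong (_without e) (sym (applyUpTo-∷ʳ suc n)) ⟩
    (oneTo n ++ [ suc n ]) without e                 ≡⟨ filter-++ _ (oneTo n) [ suc n ] ⟩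
    oneTo n without e ++ [ suc n ] without e         ≡⟨ cong (oneTo n without e ++_) last-kept ⟩
    oneTo n without e ++ [ suc n ]                   ∎
    where
    open ≡-Reasoning
    last-kept : [ suc n ] without e ≡ [ suc n ]
    last-kept rewrite elemᵇ-above e e<1+n = refl

  oneTo-without-∷ʳ-0 : ∀ n e → oneTo n without (e ++ [ 0 ]) ≡ oneTo n without e
  oneTo-without-∷ʳ-0 n e = filterᵇ-cong _ _
    (All.applyUpTo⁺₂ suc n (λ i → cong not (trans (elemᵇ-++ (suc i) e [ 0 ]) (∨-identityʳ _))))

  oneTo-without-nonzeros : ∀ n e → oneTo n without nonzeros e ≡ oneTo n without e
  oneTo-without-nonzeros n e = filterᵇ-cong _ _
    (All.applyUpTo⁺₂ suc n (λ i → cong not (elemᵇ-nonzeros i e)))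

  nonzeros-⊆-oneTo : ∀ {n} xs → All (_< n) xs → All (λ d → elemᵇ d (oneTo n) ≡ true) (nonzeros xs)
  nonzeros-⊆-oneTo []           []             = []
  nonzeros-⊆-oneTo (zero  ∷ xs) (_ ∷ xs<n)     = nonzeros-⊆-oneTo xs xs<n
  nonzeros-⊆-oneTo (suc y ∷ xs) (1+y<n ∷ xs<n) =
    elemᵇ-applyUpTo suc (<-trans (n<1+n y) 1+y<n) ∷ nonzeros-⊆-oneTo xs xs<n

  length-oneTo-without : ∀ {n e} → IsInvSeq n e → distinctᵇ (nonzeros e) ≡ true →
    length (oneTo n without e) ≡ zeros e
  length-oneTo-without {n} {e} record { length≡ = length≡ ; bounded = bounded } distinct =
    +-cancelʳ-≡ _ _ _ (begin
      length (oneTo n without e) + length (nonzeros e)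
        ≡⟨ cong (λ z → length z + length (nonzeros e)) (sym (oneTo-without-nonzeros n e)) ⟩
      length (oneTo n without nonzeros e) + length (nonzeros e)
        ≡⟨ length-without (oneTo n) _ (oneTo-increasing n) distinct (nonzeros-⊆-oneTo e bounded) ⟩
      length (oneTo n)
        ≡⟨ length-applyUpTo suc n ⟩
      n
        ≡⟨ sym length≡ ⟩
      length e
        ≡⟨ sym (zeros+length-nonzeros e) ⟩
      zeros e + length (nonzeros e) ∎)
    where open ≡-Reasoning

  Inv-suc : ∀ n e → Inv (suc n) e ≡ inv e + crossInv e (oneTo n without e)
  Inv-suc n e = trans (cong (λ R → inv (e ++ R)) (cong (_without e) (map-upTo suc n)))
                      (inv-++-increasing e (oneTo-without-increasing n e))

  crossInv-oneTo-suc : ∀ m e → All (_< suc m) e → crossInv e (oneTo (suc m) without e) ≡ crossInv e (oneTo m without e)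
  crossInv-oneTo-suc m e e<1+m = begin
    crossInv e (oneTo (suc m) without e) ≡⟨ cong (crossInv e) (oneTo-suc-without m e e<1+m) ⟩
    crossInv e (L ++ [ suc m ])          ≡⟨ crossInv-++ʳ e L [ suc m ] ⟩
    crossInv e L + crossInv e [ suc m ]  ≡⟨ cong (crossInv e L +_) (crossInv-singleton-above (suc m) e e≤1+m) ⟩
    crossInv e L + 0                     ≡⟨ +-identityʳ _ ⟩
    crossInv e L                         ∎
    where
    open ≡-Reasoning
    L = oneTo m without e
    e≤1+m = All.map <⇒≤ e<1+m

  Inv-oneTo : ∀ n e → All (_< n) e → Inv n e ≡ inv e + crossInv e (oneTo n without e)
  Inv-oneTo zero    []      []    = refl
  Inv-oneTo (suc m) e       e<1+m = trans (Inv-suc m e) (cong (inv e +_) (sym (crossInv-oneTo-suc m e e<1+m)))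

  Inv-∷ʳ-0 : ∀ n e → All (_< n) e → Inv (suc n) (e ++ [ 0 ]) ≡ Inv n e + length (nonzeros e)
  Inv-∷ʳ-0 n e e<n = begin
    Inv (suc n) (e ++ [ 0 ])
      ≡⟨ Inv-suc n (e ++ [ 0 ]) ⟩
    inv (e ++ [ 0 ]) + crossInv (e ++ [ 0 ]) (oneTo n without (e ++ [ 0 ]))
      ≡⟨ cong (λ R → inv (e ++ [ 0 ]) + crossInv (e ++ [ 0 ]) R) (oneTo-without-∷ʳ-0 n e) ⟩
    inv (e ++ [ 0 ]) + crossInv (e ++ [ 0 ]) L
      ≡⟨ cong₂ _+_ (inv-∷ʳ e 0) (crossInv-∷ʳ e 0 L) ⟩
    (inv e + crossInv e [ 0 ]) + (crossInv e L + countBelow L 0)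
      ≡⟨ cong₂ (λ a b → (inv e + a) + (crossInv e L + b))
           (crossInv-[0] e) (countBelow-none L (All.universal (λ _ → z≤n) L)) ⟩
    (inv e + length (nonzeros e)) + (crossInv e L + 0)
      ≡⟨ regroup (inv e) (length (nonzeros e)) (crossInv e L) ⟩
    (inv e + crossInv e L) + length (nonzeros e)
      ≡⟨ cong (_+ length (nonzeros e)) (sym (Inv-oneTo n e e<n)) ⟩
    Inv n e + length (nonzeros e) ∎
    where
    open ≡-Reasoning
    L = oneTo n without e
    regroup : ∀ a b c → (a + b) + (c + 0) ≡ (a + c) + b
    regroup = solve-∀

  Inv-∷ʳ-∈ : ∀ n e x → All (_< n) e → elemᵇ x (oneTo n without e) ≡ true →
    Inv (suc n) (e ++ [ x ]) ≡ Inv n e + countBelow (oneTo n without e) x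
  Inv-∷ʳ-∈ n e x e<n x∈L = begin
    Inv (suc n) (e ++ [ x ])
      ≡⟨ Inv-suc n (e ++ [ x ]) ⟩
    inv (e ++ [ x ]) + crossInv (e ++ [ x ]) (oneTo n without (e ++ [ x ]))
      ≡⟨ cong (λ R → inv (e ++ [ x ]) + crossInv (e ++ [ x ]) R) (without-++ (oneTo n) e [ x ]) ⟩
    inv (e ++ [ x ]) + crossInv (e ++ [ x ]) L′
      ≡⟨ cong₂ _+_ (inv-∷ʳ e x) (crossInv-∷ʳ e x L′) ⟩
    (inv e + crossInv e [ x ]) + (crossInv e L′ + countBelow L′ x)
      ≡⟨ regroup (inv e) (crossInv e [ x ]) (crossInv e L′) (countBelow L′ x) ⟩
    inv e + (crossInv e [ x ] + crossInv e L′) + (0 + countBelow L′ x)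
      ≡⟨ cong₂ (λ a b → inv e + a + (b + countBelow L′ x))
           (sym (crossInv-without-∈ L incL x∈L e)) (sym (countBelow-none [ x ] (≤-refl ∷ []))) ⟩
    inv e + crossInv e L + (countBelow [ x ] x + countBelow L′ x)
      ≡⟨ cong (inv e + crossInv e L +_) (sym (countBelow-without-∈ L incL x∈L x)) ⟩
    inv e + crossInv e L + countBelow L x
      ≡⟨ cong (_+ countBelow L x) (sym (Inv-oneTo n e e<n)) ⟩
    Inv n e + countBelow L x ∎
    where
    open ≡-Reasoning
    L = oneTo n without e
    L′ = L without [ x ]
    incL = oneTo-without-increasing n e
    regroup : ∀ a b c d → (a + b) + (c + d) ≡ a + (b + c) + (0 + d)
    regroup = solve-∀


module Weighted {c ℓ : Level} (R : CommutativeSemiring c ℓ) (q : CommutativeSemiring.Carrier R) where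

  open InversionCounting
  open import Data.Bool using (Bool; true; false; _∧_; not; if_then_else_)
  open import Data.Nat as ℕ using (ℕ; zero; suc; _∸_)
  open import Data.Nat.Properties using (<⇒≤; ≤-refl)
  open import Data.List using (List; []; _∷_; _++_; [_]; length; filterᵇ; map; concatMap; upTo; foldr)
  open import Data.List.Relation.Unary.All as All using (All; []; _∷_)
  import Data.List.Relation.Unary.All.Properties as All
  open import Data.List.Relation.Unary.AllPairs using ([]; _∷_)
  open import Data.Product using (_,_; proj₁; proj₂)
  open import Data.Sum using (inj₁; inj₂)
  open import Function using (_∘_)
  import Relation.Binary.PropositionalEquality as ≡
  open ≡ using (_≡_)
  open CommutativeSemiring R hiding (zero)
  open import Relation.Binary.Reasoning.Setoid setoid
  open import Algebra.Properties.CommutativeSemigroup +-commutativeSemigroup using (interchange)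

  ∑ : {A : Set} → List A → (A → Carrier) → Carrier
  ∑ xs f = foldr (λ x acc → f x + acc) 0# xs

  syntax ∑ xs (λ x → f) = ∑[ x ← xs ] f

  ≡⇒≈ : ∀ {x y} → x ≡ y → x ≈ y
  ≡⇒≈ ≡.refl = refl

  ∑-congᴬ : {A : Set} {f g : A → Carrier} (xs : List A) → All (λ x → f x ≈ g x) xs → ∑ xs f ≈ ∑ xs g
  ∑-congᴬ []       []         = refl
  ∑-congᴬ (x ∷ xs) (fx≈gx ∷ h) = +-cong fx≈gx (∑-congᴬ xs h)

  ∑-++ : {A : Set} (f : A → Carrier) (xs ys : List A) → ∑ (xs ++ ys) f ≈ ∑ xs f + ∑ ys f
  ∑-++ f []       ys = sym (+-identityˡ _)
  ∑-++ f (x ∷ xs) ys = trans (+-congˡ (∑-++ f xs ys)) (sym (+-assoc _ _ _))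

  ∑-concatMap : {A B : Set} (f : B → Carrier) (h : A → List B) (xs : List A) →
    ∑ (concatMap h xs) f ≈ ∑[ x ← xs ] ∑ (h x) f
  ∑-concatMap f h []       = refl
  ∑-concatMap f h (x ∷ xs) = trans (∑-++ f (h x) (concatMap h xs)) (+-congˡ (∑-concatMap f h xs))

  ∑-map : {A B : Set} (f : B → Carrier) (h : A → B) (xs : List A) → ∑ (map h xs) f ≈ ∑ xs (f ∘ h)
  ∑-map f h []       = refl
  ∑-map f h (x ∷ xs) = +-congˡ (∑-map f h xs)

  ∑-filterᵇ : {A : Set} (f : A → Carrier) (p : A → Bool) (xs : List A) →
    ∑ (filterᵇ p xs) f ≈ ∑[ x ← xs ] (if p x then f x else 0#)
  ∑-filterᵇ f p []       = refl
  ∑-filterᵇ f p (x ∷ xs) with p x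
  ... | true  = +-congˡ (∑-filterᵇ f p xs)
  ... | false = trans (∑-filterᵇ f p xs) (sym (+-identityˡ _))

  ∑-+ : {A : Set} (f g : A → Carrier) (xs : List A) → ∑[ x ← xs ] (f x + g x) ≈ ∑ xs f + ∑ xs g
  ∑-+ f g []       = sym (+-identityˡ _)
  ∑-+ f g (x ∷ xs) = trans (+-congˡ (∑-+ f g xs)) (interchange (f x) (g x) _ _)

  ∑-*ˡ : {A : Set} (c : Carrier) (f : A → Carrier) (xs : List A) → ∑[ x ← xs ] (c * f x) ≈ c * ∑ xs f
  ∑-*ˡ c f []       = sym (zeroʳ c)
  ∑-*ˡ c f (x ∷ xs) = trans (+-congˡ (∑-*ˡ c f xs)) (sym (distribˡ c _ _))

  ∑-0 : {A : Set} (xs : List A) → ∑[ _ ← xs ] 0# ≈ 0#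
  ∑-0 []       = refl
  ∑-0 (x ∷ xs) = trans (+-identityˡ _) (∑-0 xs)

  pow-+ : ∀ a b → pow R q (a ℕ.+ b) ≈ pow R q a * pow R q b
  pow-+ zero    b = sym (*-identityˡ _)
  pow-+ (suc a) b = trans (*-congˡ (pow-+ a b)) (sym (*-assoc _ _ _))

  qint-suc : ∀ m → qint R q (suc m) ≈ 1# + q * qint R q m
  qint-suc zero    = trans (+-identityˡ 1#) (sym (trans (+-congˡ (zeroʳ q)) (+-identityʳ 1#)))
  qint-suc (suc m) = begin
    qint R q (suc m) + q * pow R q m         ≈⟨ +-congʳ (qint-suc m) ⟩
    (1# + q * qint R q m) + q * pow R q m    ≈⟨ +-assoc _ _ _ ⟩
    1# + (q * qint R q m + q * pow R q m)    ≈⟨ +-congˡ (sym (distribˡ q _ _)) ⟩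
    1# + q * qint R q (suc m)                ∎

  -- The i-th smallest element (counting from 0) contributes q^i.
  ∑-pow-countBelow : ∀ {L} → Increasing L → ∑[ x ← L ] pow R q (countBelow L x) ≈ qint R q (length L)
  ∑-pow-countBelow {[]}    []           = refl
  ∑-pow-countBelow {y ∷ L} (y<L ∷ incL) = begin
    pow R q (countBelow (y ∷ L) y) + ∑[ x ← L ] pow R q (countBelow (y ∷ L) x)
      ≈⟨ +-cong (≡⇒≈ (≡.cong (pow R q) (countBelow-none (y ∷ L) (≤-refl ∷ All.map <⇒≤ y<L))))
                (∑-congᴬ L (All.map (λ y<x → ≡⇒≈ (≡.cong (pow R q) (countBelow-∷-below y<x))) y<L)) ⟩
    1# + ∑[ x ← L ] (q * pow R q (countBelow L x))
      ≈⟨ +-congˡ (trans (∑-*ˡ q _ L) (*-congˡ (∑-pow-countBelow incL))) ⟩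
    1# + q * qint R q (length L)
      ≈⟨ sym (qint-suc (length L)) ⟩
    qint R q (suc (length L)) ∎

  weight : ℕ → ℕ → List ℕ → Carrier
  weight n k e = if inIᵇ k e then pow R q (Inv n e) else 0#

  weightSum : ℕ → ℕ → Carrier
  weightSum n k = ∑[ e ← invSeqs n ] weight n k e

  invSum≈weightSum : ∀ n k → invSum R q n k ≈ weightSum n k
  invSum≈weightSum n k = ∑-filterᵇ (λ e → pow R q (Inv n e)) (inIᵇ k) (invSeqs n)

  zero-extension : ∀ {n e} k → IsInvSeq n e → weight (suc n) (suc k) (e ++ [ 0 ]) ≈ pow R q (n ∸ k) * weight n k e
  zero-extension {n} {e} k e-inv rewrite inIᵇ-∷ʳ-0 k e with inIᵇ k e in e∈I
  ... | false = sym (zeroʳ _)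
  ... | true  = begin
    pow R q (Inv (suc n) (e ++ [ 0 ]))        ≡⟨ ≡.cong (pow R q) (Inv-∷ʳ-0 n e (IsInvSeq.bounded e-inv)) ⟩
    pow R q (Inv n e ℕ.+ length (nonzeros e)) ≡⟨ ≡.cong (λ m → pow R q (Inv n e ℕ.+ m)) nonzeros≡ ⟩
    pow R q (Inv n e ℕ.+ (n ∸ k))             ≈⟨ pow-+ (Inv n e) (n ∸ k) ⟩
    pow R q (Inv n e) * pow R q (n ∸ k)       ≈⟨ *-comm _ _ ⟩
    pow R q (n ∸ k) * pow R q (Inv n e)       ∎
    where
    nonzeros≡ : length (nonzeros e) ≡ n ∸ k
    nonzeros≡ = ≡.trans (length-nonzeros e-inv) (≡.cong (n ∸_) (proj₁ (inIᵇ-true k e e∈I)))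

  available-extensions : ∀ {n e} k → IsInvSeq n e → inIᵇ (suc k) e ≡ true →
    ∑[ x ← oneTo n without e ] pow R q (Inv (suc n) (e ++ [ x ])) ≈ qint R q (suc k) * pow R q (Inv n e)
  available-extensions {n} {e} k e-inv e∈I = begin
    ∑[ x ← L ] pow R q (Inv (suc n) (e ++ [ x ]))
      ≈⟨ ∑-congᴬ L (All.map (λ {x} → Inv-grows x) (elemᵇ-self L)) ⟩
    ∑[ x ← L ] (pow R q (Inv n e) * pow R q (countBelow L x))
      ≈⟨ ∑-*ˡ (pow R q (Inv n e)) _ L ⟩
    pow R q (Inv n e) * ∑[ x ← L ] pow R q (countBelow L x)
      ≈⟨ *-congˡ (∑-pow-countBelow (oneTo-without-increasing n e)) ⟩
    pow R q (Inv n e) * qint R q (length L)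
      ≡⟨ ≡.cong (λ m → pow R q (Inv n e) * qint R q m)
           (≡.trans (length-oneTo-without e-inv distinct) zeros≡) ⟩
    pow R q (Inv n e) * qint R q (suc k)
      ≈⟨ *-comm _ _ ⟩
    qint R q (suc k) * pow R q (Inv n e) ∎
    where
    L = oneTo n without e
    zeros≡ = proj₁ (inIᵇ-true (suc k) e e∈I)
    distinct = proj₂ (inIᵇ-true (suc k) e e∈I)
    Inv-grows : ∀ x → elemᵇ x L ≡ true →
      pow R q (Inv (suc n) (e ++ [ x ])) ≈ pow R q (Inv n e) * pow R q (countBelow L x)
    Inv-grows x x∈L =
      trans (≡⇒≈ (≡.cong (pow R q) (Inv-∷ʳ-∈ n e x (IsInvSeq.bounded e-inv) x∈L))) (pow-+ (Inv n e) _)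

  nonzero-extensions : ∀ {n e} k → IsInvSeq n e →
    ∑[ x ← oneTo n ] weight (suc n) (suc k) (e ++ [ x ]) ≈ qint R q (suc k) * weight n (suc k) e
  nonzero-extensions {n} {e} k e-inv =
    trans (∑-congᴬ (oneTo n) (All.applyUpTo⁺₂ suc n split)) (by-cases (inIᵇ (suc k) e) ≡.refl)
    where
    V : ℕ → Carrier
    V x = pow R q (Inv (suc n) (e ++ [ x ]))
    split : ∀ i → weight (suc n) (suc k) (e ++ [ suc i ])
                    ≈ (if inIᵇ (suc k) e ∧ not (elemᵇ (suc i) e) then V (suc i) else 0#)
    split i = ≡⇒≈ (≡.cong (λ b → if b then V (suc i) else 0#) (inIᵇ-∷ʳ-suc (suc k) e i))
    by-cases : ∀ b → inIᵇ (suc k) e ≡ b →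
      ∑[ x ← oneTo n ] (if b ∧ not (elemᵇ x e) then V x else 0#) ≈ qint R q (suc k) * weight n (suc k) e
    by-cases false e∉I rewrite e∉I = trans (∑-0 (oneTo n)) (sym (zeroʳ _))
    by-cases true  e∈I rewrite e∈I =
      trans (sym (∑-filterᵇ V (λ x → not (elemᵇ x e)) (oneTo n))) (available-extensions k e-inv e∈I)

  -- upTo (suc n) unfolds to 0 ∷ oneTo n.
  extensions : ∀ {n e} k → IsInvSeq n e →
    ∑[ x ← upTo (suc n) ] weight (suc n) (suc k) (e ++ [ x ])
      ≈ pow R q (n ∸ k) * weight n k e + qint R q (suc k) * weight n (suc k) e
  extensions k e-inv = +-cong (zero-extension k e-inv) (nonzero-extensions k e-inv)

  weightSum-suc : ∀ n k →
    weightSum (suc n) (suc k) ≈ pow R q (n ∸ k) * weightSum n k + qint R q (suc k) * weightSum n (suc k)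
  weightSum-suc n k = begin
    ∑ (invSeqs (suc n)) (weight (suc n) (suc k))
      ≈⟨ ∑-concatMap (weight (suc n) (suc k)) children (invSeqs n) ⟩
    ∑[ e ← invSeqs n ] ∑ (children e) (weight (suc n) (suc k))
      ≈⟨ ∑-congᴬ (invSeqs n) (All.map (λ {e} → children-sum e) (invSeqs-IsInvSeq n)) ⟩
    ∑[ e ← invSeqs n ] (pow R q (n ∸ k) * weight n k e + qint R q (suc k) * weight n (suc k) e)
      ≈⟨ ∑-+ _ _ (invSeqs n) ⟩
    ∑[ e ← invSeqs n ] (pow R q (n ∸ k) * weight n k e)
      + ∑[ e ← invSeqs n ] (qint R q (suc k) * weight n (suc k) e)
      ≈⟨ +-cong (∑-*ˡ _ _ (invSeqs n)) (∑-*ˡ _ _ (invSeqs n)) ⟩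
    pow R q (n ∸ k) * weightSum n k + qint R q (suc k) * weightSum n (suc k) ∎
    where
    children : List ℕ → List (List ℕ)
    children e = map (λ x → e ++ [ x ]) (upTo (suc n))
    children-sum : ∀ e → IsInvSeq n e → ∑ (children e) (weight (suc n) (suc k))
      ≈ pow R q (n ∸ k) * weight n k e + qint R q (suc k) * weight n (suc k) e
    children-sum e e-inv = trans (∑-map _ (λ x → e ++ [ x ]) (upTo (suc n))) (extensions k e-inv)

  weightSum-suc-0 : ∀ n → weightSum (suc n) 0 ≈ 0#
  weightSum-suc-0 n =
    trans (∑-congᴬ (invSeqs (suc n)) (All.map has-zero (invSeqs-IsInvSeq (suc n)))) (∑-0 (invSeqs (suc n)))
    where
    has-zero : ∀ {e} → IsInvSeq (suc n) e → weight (suc n) 0 e ≈ 0#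
    has-zero record { startsWithZero = inj₂ (_ , ≡.refl) } = refl
    has-zero record { length≡ = () ; startsWithZero = inj₁ ≡.refl }

  Sq≈weightSum : ∀ n k → Sq R q n k ≈ weightSum n k
  Sq≈weightSum zero    zero    = sym (+-identityʳ 1#)
  Sq≈weightSum zero    (suc k) = sym (+-identityʳ 0#)
  Sq≈weightSum (suc n) zero    = trans (zeroˡ _) (sym (weightSum-suc-0 n))
  Sq≈weightSum (suc n) (suc k) =
    trans (+-cong (*-congˡ (Sq≈weightSum n k)) (*-congˡ (Sq≈weightSum n (suc k)))) (sym (weightSum-suc n k))


mainTheorem10 : ∀ {c ℓ : Level} (R : CommutativeSemiring c ℓ) (q : CommutativeSemiring.Carrier R)
                  (n k : ℕ) → 1 ≤ n → 1 ≤ k → k ≤ n →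
                  CommutativeSemiring._≈_ R (Sq R q n k) (invSum R q n k)
-- The identity holds for all n and k.
mainTheorem10 R q n k _ _ _ = trans (Sq≈weightSum n k) (sym (invSum≈weightSum n k))
  where
  open CommutativeSemiring R using (trans; sym)
  open Weighted R q
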